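{- Let $F$ be rule $234$ on the square grid, let $x\in\{0,1\}^{\{0,\dots,n-1\}^2}$ be a finite configuration and let $u\in\{0,\dots,n-1\}^2$ with $x_u=0$. Then $u$ is stable for $c(x)$ if and only if $u$ is stable for $D(c)$.
   Context: Square grid: neighbors $N(u)$ of $u\in\mathbb{Z}^2$ are the four cells at Manhattan distance 1. Rule $234$: $F(c)_u=1$ if $c_u=1$ or $\sum_{v\in N(u)}c_v\in\{2,3,4\}$, else $F(c)_u=0$, applied synchronously (1 = active, 0 = inactive). For a finite configuration $y$ on a $k\times k$ block, $c(y)$ is the periodic configuration on $\mathbb{Z}^2$ obtained by repeating $y$ in all directions. A cell $u$ with $c_u=0$ is stable for $c$ if $F^t(c)_u=0$ for all $t\ge 0$. Construction $D$: let $m=2n^2+3n$ and index an $m\times m$ block by $\{ -n^2-n,\dots,n^2+2n-1\}^2$; set $D(x)_{(i,j)}=x_{(i\bmod n,\,j\bmod n)}$ if $-n^2\le i,j\le n^2+n-1$ (the interior, a tiling by copies of $x$ of side $2n^2+n$ containing the original copy at $\{0,\dots,n-1\}^2$), and $D(x)_{(i,j)}=0$ otherwise (a frame of width $n$ of inactive cells). Then $D(c)=c(D(x))$, which is $m$-periodic. -}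

module Defs where

open import Data.Bool using (Bool; true; false; _∨_; if_then_else_)
open import Data.Nat as ℕ using (ℕ; zero; suc; NonZero)
open import Data.Nat.Properties using (m*n≢0)
open import Data.Nat.DivMod using (_mod_)
open import Data.Integer as ℤ using (ℤ; +_; -_; _%ℕ_)
open import Data.Integer.Properties using (_≤?_)
open import Data.Fin using (Fin; toℕ)
open import Data.Product using (_×_; _,_)
open import Function using (_∘_)
open import Relation.Nullary.Decidable using (⌊_⌋; _×-dec_)
open import Relation.Binary.PropositionalEquality using (_≡_)

-- Cells of the square grid and configurations (true = active, false = inactive)
Cell : Set
Cell = ℤ × ℤ

Config : Set
Config = Cell → Bool

Block : ℕ → Set
Block n = Fin n → Fin n → Bool

b2n : Bool → ℕ
b2n true  = 1
b2n false = 0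

nbSum : Config → Cell → ℕ
nbSum c (i , j) =
  b2n (c (i ℤ.+ ℤ.1ℤ , j)) ℕ.+ b2n (c (i ℤ.- ℤ.1ℤ , j)) ℕ.+
  b2n (c (i , j ℤ.+ ℤ.1ℤ)) ℕ.+ b2n (c (i , j ℤ.- ℤ.1ℤ))

in234 : ℕ → Bool
in234 s = ⌊ (2 ℕ.≤? s) ×-dec (s ℕ.≤? 4) ⌋

F : Config → Config
F c u = c u ∨ in234 (nbSum c u)

iterF : ℕ → Config → Config
iterF zero    c = c
iterF (suc t) c = F (iterF t c)

Stable : Config → Cell → Set
Stable c u = c u ≡ false × (∀ t → iterF t c u ≡ false)

modF : (n : ℕ) .{{_ : NonZero n}} → ℤ → Fin n
modF n i = (i %ℕ n) mod n

cOf : (n : ℕ) .{{_ : NonZero n}} → Block n → Config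
cOf n x (i , j) = x (modF n i) (modF n j)

-- side length m = 2n²+3n = n(2n+3) of D(x)
side : ℕ → ℕ
side n = n ℕ.* (3 ℕ.+ 2 ℕ.* n)

side-nz : (n : ℕ) .{{_ : NonZero n}} → NonZero (side n)
side-nz n = m*n≢0 n (3 ℕ.+ 2 ℕ.* n)

-- D(x), as a function on its index set {-n²-n,...,n²+2n-1}²:
-- x(i mod n, j mod n) on the interior -n² ≤ i,j ≤ n²+n-1, and 0 on the frame
inInterior : ℕ → ℤ → Bool
inInterior n i = ⌊ (- (+ (n ℕ.* n)) ≤? i) ×-dec (i ≤? + (n ℕ.* n ℕ.+ n) ℤ.- ℤ.1ℤ) ⌋

DBlock : (n : ℕ) .{{_ : NonZero n}} → Block n → Cell → Bool
DBlock n x (i , j) =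
  if inInterior n i then
    (if inInterior n j then x (modF n i) (modF n j) else false)
  else false

lo : ℕ → ℤ
lo n = - (+ (n ℕ.* n ℕ.+ n))

repD : (n : ℕ) .{{_ : NonZero n}} → ℤ → ℤ
repD n i = lo n ℤ.+ + (_%ℕ_ (i ℤ.- lo n) (side n) {{side-nz n}})

-- D(c) = c(D(x)): periodic repetition (period m) of the block D(x)
Dc : (n : ℕ) .{{_ : NonZero n}} → Block n → Config
Dc n x (i , j) = DBlock n x (repD n i , repD n j)

embed : {n : ℕ} → Fin n × Fin n → Cell
embed (a , b) = (+ toℕ a , + toℕ b)

module Submission where

-- Write cX = c(x) and cD = D(c).  Rule 234 is monotone (more active cells never
-- prevent an activation), inflationary (active cells stay active) and local (a cell
-- only sees its four neighbours).  The two directions of the theorem use these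
-- facts as follows.
--  (⇒) cD arises from cX by switching cells off, cD ⊑ cX; by monotonicity every
--      iterate of cD lies below the corresponding iterate of cX.
--  (⇐) cX is n-periodic, so its active cells can be counted on one n×n period.
--      The count is nondecreasing and bounded by n², hence some step leaves it
--      unchanged; then F fixes the configuration.  So cX is frozen after at most
--      n² steps and every cell that ever activates is active at time n².  On the
--      other hand cX and cD coincide on the box [-n², n²+n-1]², and by locality
--      their t-th iterates coincide on that box shrunk by t; for t = n² the
--      shrunk box still contains the original block {0..n-1}².

open import Defs
open import Data.Bool using (Bool; true; false; _∨_)
open import Data.Bool.Properties using (T-≡; ∨-zeroʳ)
open import Data.Nat as ℕ using (ℕ; zero; suc; NonZero; z≤n; s≤s; _≤′_; ≤′-reflexive; ≤′-step)
import Data.Nat.Properties as ℕP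
open import Data.Nat.DivMod using (_mod_; m<n⇒m%n≡m)
import Data.Nat.Tactic.RingSolver as ℕSolver
open import Data.Integer as ℤ using (ℤ; +_; -[1+_]; _%ℕ_; _/ℕ_; _+_; _-_; _*_; -_; 0ℤ; 1ℤ; -1ℤ; _≤_; _<_; +≤+; +<+)
import Data.Integer.Properties as ℤP
open import Data.Integer.DivMod using (a≡a%ℕn+[a/ℕn]*n; n%ℕd<d)
open import Data.Integer.Tactic.RingSolver using (solve-∀)
open import Data.Fin using (Fin; toℕ)
open import Data.Fin.Properties using (toℕ<n)
open import Data.Empty using (⊥-elim)
open import Data.Sum using (_⊎_; inj₁; inj₂)
open import Data.Product using (_×_; _,_; Σ-syntax)
open import Function.Bundles using (_⇔_; mk⇔; Equivalence)
open import Relation.Nullary using (yes; no)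
open import Relation.Nullary.Decidable using (toWitness; fromWitness)
open import Relation.Binary.PropositionalEquality

residue-no-wrap : ∀ {r r' d} j → r ℕ.< d → + r ≢ + r' + + suc j * + d
residue-no-wrap {r} {r'} {d} j r<d eq = ℕP.<⇒≱ r<d d≤r
  where
  r≡ : r ≡ r' ℕ.+ suc j ℕ.* d
  r≡ = ℤP.+-injective (trans eq (sym (trans (ℤP.pos-+ r' (suc j ℕ.* d))
                                            (cong (_+_ (+ r')) (ℤP.pos-* (suc j) d)))))
  d≤r : d ℕ.≤ r
  d≤r = subst (d ℕ.≤_) (sym r≡) (ℕP.≤-trans (ℕP.m≤m+n d (j ℕ.* d)) (ℕP.m≤n+m _ r'))

move-multiple : ∀ (a b q q' d : ℤ) → a + q * d ≡ b + q' * d → a ≡ b + (q' - q) * d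
move-multiple a b q q' d eq = begin
  a                    ≡⟨ cancel a q d ⟩
  (a + q * d) - q * d  ≡⟨ cong (_- q * d) eq ⟩
  (b + q' * d) - q * d ≡⟨ regroup b q' q d ⟩
  b + (q' - q) * d     ∎
  where
  open ≡-Reasoning
  cancel : ∀ (a q d : ℤ) → a ≡ (a + q * d) - q * d
  cancel = solve-∀
  regroup : ∀ (b q' q d : ℤ) → (b + q' * d) - q * d ≡ b + (q' - q) * d
  regroup = solve-∀

solve-for : ∀ (a b k d : ℤ) → a ≡ b + k * d → b ≡ a + (- k) * d
solve-for a b k d eq = trans (cancel b k d) (cong (_+ (- k) * d) (sym eq))
  where
  cancel : ∀ (b k d : ℤ) → b ≡ (b + k * d) + (- k) * d
  cancel = solve-∀

residue-unique : ∀ {r r' d} (q q' : ℤ) → r ℕ.< d → r' ℕ.< d →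
                 + r + q * + d ≡ + r' + q' * + d → r ≡ r'
residue-unique {r} {r'} {d} q q' r<d r'<d eq
  with q' - q | move-multiple (+ r) (+ r') q q' (+ d) eq
... | + zero   | e = ℤP.+-injective (trans e (ℤP.+-identityʳ (+ r')))
... | + suc j  | e = ⊥-elim (residue-no-wrap j r<d e)
... | -[1+ j ] | e = ⊥-elim (residue-no-wrap j r'<d (solve-for (+ r) (+ r') -[1+ j ] (+ d) e))

%ℕ-unique : ∀ a d .{{_ : NonZero d}} r (q : ℤ) → r ℕ.< d → a ≡ + r + q * + d → a %ℕ d ≡ r
%ℕ-unique a d r q r<d eq =
  residue-unique (a /ℕ d) q (n%ℕd<d a d) r<d (trans (sym (a≡a%ℕn+[a/ℕn]*n a d)) eq)

%ℕ-translate : ∀ i k d .{{_ : NonZero d}} → (i + k * + d) %ℕ d ≡ i %ℕ d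
%ℕ-translate i k d = %ℕ-unique (i + k * + d) d (i %ℕ d) (i /ℕ d + k) (n%ℕd<d i d) (begin
  i + k * + d                            ≡⟨ cong (_+ k * + d) (a≡a%ℕn+[a/ℕn]*n i d) ⟩
  (+ (i %ℕ d) + i /ℕ d * + d) + k * + d  ≡⟨ regroup (+ (i %ℕ d)) (i /ℕ d) k (+ d) ⟩
  + (i %ℕ d) + (i /ℕ d + k) * + d        ∎)
  where
  open ≡-Reasoning
  regroup : ∀ (r q k d : ℤ) → (r + q * d) + k * d ≡ r + (q + k) * d
  regroup = solve-∀

%ℕ-small : ∀ a m .{{_ : NonZero m}} → 0ℤ ≤ a → a < + m → + (a %ℕ m) ≡ a
%ℕ-small (+ k) m _ (+<+ k<m) = cong +_ (m<n⇒m%n≡m k<m)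

F-local : ∀ (c c' : Config) i j i' j' →
  c (i , j) ≡ c' (i' , j') →
  c (i + 1ℤ , j) ≡ c' (i' + 1ℤ , j') → c (i - 1ℤ , j) ≡ c' (i' - 1ℤ , j') →
  c (i , j + 1ℤ) ≡ c' (i' , j' + 1ℤ) → c (i , j - 1ℤ) ≡ c' (i' , j' - 1ℤ) →
  F c (i , j) ≡ F c' (i' , j')
F-local c c' i j i' j' e₀ e₁ e₂ e₃ e₄ =
  cong₂ _∨_ e₀ (cong in234 (cong₂ ℕ._+_ (cong₂ ℕ._+_ (cong₂ ℕ._+_ (cong b2n e₁) (cong b2n e₂))
                                                    (cong b2n e₃))
                                        (cong b2n e₄)))

F-cong : ∀ {c c'} → c ≗ c' → F c ≗ F c'
F-cong {c} {c'} e (i , j) = F-local c c' i j i j (e _) (e _) (e _) (e _) (e _)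

translate : ℤ → ℤ → Config → Config
translate p q c (i , j) = c (i + p , j + q)

F-translate : ∀ c p q i j → F (translate p q c) (i , j) ≡ F c (i + p , j + q)
F-translate c p q i j = F-local (translate p q c) c i j (i + p) (j + q) refl
  (cong (λ z → c (z , j + q)) (swap i 1ℤ p)) (cong (λ z → c (z , j + q)) (swap i (- 1ℤ) p))
  (cong (λ z → c (i + p , z)) (swap j 1ℤ q)) (cong (λ z → c (i + p , z)) (swap j (- 1ℤ) q))
  where
  swap : ∀ (i s p : ℤ) → (i + s) + p ≡ (i + p) + s
  swap = solve-∀

Periodic : ℕ → Config → Set
Periodic n c = ∀ k l → translate (k * + n) (l * + n) c ≗ c

-- Since F commutes with translations, it preserves periodicity.
F-periodic : ∀ {n c} → Periodic n c → Periodic n (F c)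
F-periodic {n} {c} per k l (i , j) =
  trans (sym (F-translate c (k * + n) (l * + n) i j)) (F-cong (per k l) (i , j))

iterF-periodic : ∀ {n c} → Periodic n c → ∀ t → Periodic n (iterF t c)
iterF-periodic per zero    = per
iterF-periodic per (suc t) = F-periodic (iterF-periodic per t)

cOf-periodic : ∀ n .{{_ : NonZero n}} x → Periodic n (cOf n x)
cOf-periodic n x k l (i , j) = cong₂ x (modF-translate i k) (modF-translate j l)
  where
  modF-translate : ∀ i k → modF n (i + k * + n) ≡ modF n i
  modF-translate i k = cong (λ r → r mod n) (%ℕ-translate i k n)

periodic-reduce : ∀ n .{{_ : NonZero n}} {c} → Periodic n c →
                  ∀ i j → c (i , j) ≡ c (+ (i %ℕ n) , + (j %ℕ n))
periodic-reduce n {c} per i j =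
  trans (cong₂ (λ p q → c (p , q)) (a≡a%ℕn+[a/ℕn]*n i n) (a≡a%ℕn+[a/ℕn]*n j n))
        (per (i /ℕ n) (j /ℕ n) (+ (i %ℕ n) , + (j %ℕ n)))

_⊑_ : Config → Config → Set
c ⊑ c' = ∀ u → c u ≡ true → c' u ≡ true

⊑-inactive : ∀ {b b' : Bool} → (b ≡ true → b' ≡ true) → b' ≡ false → b ≡ false
⊑-inactive {false} _   _  = refl
⊑-inactive {true}  b⇒b' b'≡f = trans (sym (b⇒b' refl)) b'≡f

in234-sound : ∀ {s} → in234 s ≡ true → 2 ℕ.≤ s
in234-sound e = let (2≤s , _) = toWitness (Equivalence.from T-≡ e) in 2≤s

in234-complete : ∀ {s} → 2 ℕ.≤ s → s ℕ.≤ 4 → in234 s ≡ true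
in234-complete 2≤s s≤4 = Equivalence.to T-≡ (fromWitness (2≤s , s≤4))

b2n≤1 : ∀ b → b2n b ℕ.≤ 1
b2n≤1 true  = s≤s z≤n
b2n≤1 false = z≤n

b2n-mono : ∀ {b b'} → (b ≡ true → b' ≡ true) → b2n b ℕ.≤ b2n b'
b2n-mono {false} _    = z≤n
b2n-mono {true}  b⇒b' rewrite b⇒b' refl = ℕP.≤-refl

nbSum≤4 : ∀ c u → nbSum c u ℕ.≤ 4
nbSum≤4 c (i , j) =
  ℕP.+-mono-≤ (ℕP.+-mono-≤ (ℕP.+-mono-≤ (b2n≤1 (c (i + 1ℤ , j))) (b2n≤1 (c (i - 1ℤ , j))))
                          (b2n≤1 (c (i , j + 1ℤ))))
              (b2n≤1 (c (i , j - 1ℤ)))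

nbSum-mono : ∀ {c c'} → c ⊑ c' → ∀ u → nbSum c u ℕ.≤ nbSum c' u
nbSum-mono c⊑c' (i , j) =
  ℕP.+-mono-≤ (ℕP.+-mono-≤ (ℕP.+-mono-≤ (b2n-mono (c⊑c' _)) (b2n-mono (c⊑c' _)))
                          (b2n-mono (c⊑c' _)))
              (b2n-mono (c⊑c' _))

-- Rule 234 is monotone: since the window {2,3,4} is upward closed below the
-- maximal neighbour count 4, more active neighbours never prevent activation.
F-mono : ∀ {c c'} → c ⊑ c' → F c ⊑ F c'
F-mono {c} {c'} c⊑c' u Fc-active with c u in cu
... | true  = cong (_∨ in234 (nbSum c' u)) (c⊑c' u cu)
... | false = subst (λ b → c' u ∨ b ≡ true)
                    (sym (in234-complete (ℕP.≤-trans (in234-sound Fc-active) (nbSum-mono c⊑c' u))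
                                         (nbSum≤4 c' u)))
                    (∨-zeroʳ (c' u))

iterF-mono : ∀ {c c'} → c ⊑ c' → ∀ t → iterF t c ⊑ iterF t c'
iterF-mono c⊑c' zero    = c⊑c'
iterF-mono c⊑c' (suc t) = F-mono (iterF-mono c⊑c' t)

F-inflationary : ∀ c → c ⊑ F c
F-inflationary c u e = cong (_∨ in234 (nbSum c u)) e

iterF-grows : ∀ c {s t} → s ≤′ t → iterF s c ⊑ iterF t c
iterF-grows c (≤′-reflexive refl) u e = e
iterF-grows c (≤′-step {t} s≤t)   u e = F-inflationary (iterF t c) u (iterF-grows c s≤t u e)

Fixed : Config → Set
Fixed c = F c ≗ c

iterF-frozen : ∀ c {s t} → Fixed (iterF s c) → s ≤′ t → iterF t c ≗ iterF s c
iterF-frozen c fixed (≤′-reflexive refl) u = refl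
iterF-frozen c {s} fixed (≤′-step {t} s≤t) u =
  trans (F-cong {iterF t c} {iterF s c} (iterF-frozen c fixed s≤t) u) (fixed u)

sumBelow : ℕ → (ℕ → ℕ) → ℕ
sumBelow zero    f = 0
sumBelow (suc k) f = f k ℕ.+ sumBelow k f

sum-mono : ∀ k {f g} → (∀ a → a ℕ.< k → f a ℕ.≤ g a) → sumBelow k f ℕ.≤ sumBelow k g
sum-mono zero    f≤g = z≤n
sum-mono (suc k) f≤g =
  ℕP.+-mono-≤ (f≤g k ℕP.≤-refl) (sum-mono k (λ a a<k → f≤g a (ℕP.m≤n⇒m≤1+n a<k)))

sum-strict : ∀ k {f g} → (∀ a → a ℕ.< k → f a ℕ.≤ g a) →
             ∀ a₀ → a₀ ℕ.< k → f a₀ ℕ.< g a₀ → sumBelow k f ℕ.< sumBelow k g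
sum-strict (suc k) f≤g a₀ a₀<1+k f<g with a₀ ℕP.≟ k
... | yes refl = ℕP.+-mono-<-≤ f<g (sum-mono k (λ a a<k → f≤g a (ℕP.m≤n⇒m≤1+n a<k)))
... | no  a₀≢k = ℕP.+-mono-≤-< (f≤g k ℕP.≤-refl)
                   (sum-strict k (λ a a<k → f≤g a (ℕP.m≤n⇒m≤1+n a<k)) a₀
                               (ℕP.≤∧≢⇒< (ℕP.≤-pred a₀<1+k) a₀≢k) f<g)

sum-bound : ∀ k {f} B → (∀ a → a ℕ.< k → f a ℕ.≤ B) → sumBelow k f ℕ.≤ k ℕ.* B
sum-bound zero    B f≤B = z≤n
sum-bound (suc k) B f≤B =
  ℕP.+-mono-≤ (f≤B k ℕP.≤-refl) (sum-bound k B (λ a a<k → f≤B a (ℕP.m≤n⇒m≤1+n a<k)))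

count : ℕ → Config → ℕ
count n c = sumBelow n (λ a → sumBelow n (λ b → b2n (c (+ a , + b))))

count-bound : ∀ n c → count n c ℕ.≤ n ℕ.* n
count-bound n c = subst (λ m → count n c ℕ.≤ n ℕ.* m) (ℕP.*-identityʳ n)
  (sum-bound n (n ℕ.* 1) (λ a _ → sum-bound n 1 (λ b _ → b2n≤1 (c (+ a , + b)))))

count-mono : ∀ n {c c'} → c ⊑ c' → count n c ℕ.≤ count n c'
count-mono n c⊑c' = sum-mono n (λ a _ → sum-mono n (λ b _ → b2n-mono (c⊑c' _)))

count-strict : ∀ n {c c'} → c ⊑ c' → ∀ a b → a ℕ.< n → b ℕ.< n →
               c (+ a , + b) ≡ false → c' (+ a , + b) ≡ true → count n c ℕ.< count n c'
count-strict n {c} {c'} c⊑c' a b a<n b<n off on =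
  sum-strict n (λ a _ → sum-mono n (λ b _ → b2n-mono (c⊑c' _))) a a<n
    (sum-strict n (λ b _ → b2n-mono (c⊑c' _)) b b<n
      (subst₂ (λ v v' → b2n v ℕ.< b2n v') (sym off) (sym on) ℕP.≤-refl))

count-rigid : ∀ n {c c'} → c ⊑ c' → count n c ≡ count n c' →
              ∀ a b → a ℕ.< n → b ℕ.< n → c' (+ a , + b) ≡ c (+ a , + b)
count-rigid n {c} {c'} c⊑c' same a b a<n b<n with c (+ a , + b) in cu | c' (+ a , + b) in c'u
... | true  | true  = refl
... | false | false = refl
... | true  | false = trans (sym c'u) (c⊑c' _ cu)
... | false | true  = ⊥-elim (ℕP.<-irrefl same (count-strict n c⊑c' a b a<n b<n cu c'u))

plateau : (f : ℕ → ℕ) → (∀ t → f t ℕ.≤ f (suc t)) → ∀ B → (∀ t → f t ℕ.≤ B) →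
          Σ[ s ∈ ℕ ] s ℕ.≤ B × f s ≡ f (suc s)
plateau f mono B bound = conclude (climb (suc B))
  where
  climb : ∀ t → (Σ[ s ∈ ℕ ] s ℕ.< t × f s ≡ f (suc s)) ⊎ t ℕ.≤ f t
  climb zero = inj₂ z≤n
  climb (suc t) with climb t
  ... | inj₁ (s , s<t , flat) = inj₁ (s , ℕP.m≤n⇒m≤1+n s<t , flat)
  ... | inj₂ t≤ft with f t ℕP.≟ f (suc t)
  ...   | yes flat = inj₁ (t , ℕP.≤-refl , flat)
  ...   | no  rise = inj₂ (ℕP.≤-trans (s≤s t≤ft) (ℕP.≤∧≢⇒< (mono t) rise))
  conclude : (Σ[ s ∈ ℕ ] s ℕ.< suc B × f s ≡ f (suc s)) ⊎ suc B ℕ.≤ f (suc B) →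
             Σ[ s ∈ ℕ ] s ℕ.≤ B × f s ≡ f (suc s)
  conclude (inj₁ (s , s<1+B , flat)) = s , ℕP.≤-pred s<1+B , flat
  conclude (inj₂ 1+B≤f) = ⊥-elim (ℕP.n≮n B (ℕP.≤-trans 1+B≤f (bound (suc B))))

periodic-fixed : ∀ n .{{_ : NonZero n}} {c} → Periodic n c →
  (∀ a b → a ℕ.< n → b ℕ.< n → F c (+ a , + b) ≡ c (+ a , + b)) → Fixed c
periodic-fixed n {c} per onPeriod (i , j) = begin
  F c (i , j)                       ≡⟨ periodic-reduce n (F-periodic per) i j ⟩
  F c (+ (i %ℕ n) , + (j %ℕ n))     ≡⟨ onPeriod _ _ (n%ℕd<d i n) (n%ℕd<d j n) ⟩
  c (+ (i %ℕ n) , + (j %ℕ n))       ≡⟨ periodic-reduce n per i j ⟨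
  c (i , j)                         ∎
  where open ≡-Reasoning

-- An n-periodic configuration reaches a fixed point of F within n² steps: the
-- active count on a period grows until a step leaves it (hence the period) unchanged.
periodic-stabilises : ∀ n .{{_ : NonZero n}} {c} → Periodic n c →
                      Σ[ s ∈ ℕ ] s ℕ.≤ n ℕ.* n × Fixed (iterF s c)
periodic-stabilises n {c} per with
  plateau (λ t → count n (iterF t c)) (λ t → count-mono n (F-inflationary (iterF t c)))
          (n ℕ.* n) (λ t → count-bound n (iterF t c))
... | s , s≤n² , flat =
  s , s≤n² , periodic-fixed n (iterF-periodic per s) (count-rigid n (F-inflationary (iterF s c)) flat)

periodic-active-by : ∀ n .{{_ : NonZero n}} {c} → Periodic n c →
                     ∀ t u → iterF t c u ≡ true → iterF (n ℕ.* n) c u ≡ true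
periodic-active-by n {c} per t u active with periodic-stabilises n per
... | s , s≤n² , fixed with ℕP.≤-total t (n ℕ.* n)
...   | inj₁ t≤n² = iterF-grows c (ℕP.≤⇒≤′ t≤n²) u active
...   | inj₂ n²≤t = iterF-grows c (ℕP.≤⇒≤′ s≤n²) u
                      (trans (sym (iterF-frozen c fixed (ℕP.≤⇒≤′ (ℕP.≤-trans s≤n² n²≤t)) u)) active)

InRange : ℤ → ℤ → ℤ → Set
InRange L H i = L ≤ i × i ≤ H

AgreeOn : ℤ → ℤ → Config → Config → Set
AgreeOn L H c c' = ∀ i j → InRange L H i → InRange L H j → c (i , j) ≡ c' (i , j)

neighbours-in-range : ∀ {L H i} → InRange (L + 1ℤ) (H - 1ℤ) i →
                      InRange L H (i - 1ℤ) × InRange L H i × InRange L H (i + 1ℤ)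
neighbours-in-range {L} {H} {i} (L+1≤i , i≤H-1) =
  (L≤i-1 , ℤP.≤-trans (ℤP.i-j≤i i 1ℤ) i≤H) ,
  (L≤i , i≤H) ,
  (ℤP.≤-trans L≤i (ℤP.i≤i+j i 1ℤ) , i+1≤H)
  where
  cancel₁ : ∀ (a : ℤ) → (a + 1ℤ) - 1ℤ ≡ a
  cancel₁ = solve-∀
  cancel₂ : ∀ (a : ℤ) → (a - 1ℤ) + 1ℤ ≡ a
  cancel₂ = solve-∀
  L≤i-1 : L ≤ i - 1ℤ
  L≤i-1 = subst (_≤ i - 1ℤ) (cancel₁ L) (ℤP.+-monoˡ-≤ (- 1ℤ) L+1≤i)
  i+1≤H : i + 1ℤ ≤ H
  i+1≤H = subst (i + 1ℤ ≤_) (cancel₂ H) (ℤP.+-monoˡ-≤ 1ℤ i≤H-1)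
  L≤i : L ≤ i
  L≤i = ℤP.≤-trans L≤i-1 (ℤP.i-j≤i i 1ℤ)
  i≤H : i ≤ H
  i≤H = ℤP.≤-trans (ℤP.i≤i+j i 1ℤ) i+1≤H

agree-step : ∀ {L H c c'} → AgreeOn L H c c' → AgreeOn (L + 1ℤ) (H - 1ℤ) (F c) (F c')
agree-step {c = c} {c'} agree i j ri rj
  with neighbours-in-range ri | neighbours-in-range rj
... | ri₋ , ri₀ , ri₊ | rj₋ , rj₀ , rj₊ =
  F-local c c' i j i j (agree i j ri₀ rj₀)
    (agree _ _ ri₊ rj₀) (agree _ _ ri₋ rj₀) (agree _ _ ri₀ rj₊) (agree _ _ ri₀ rj₋)

agree-iter : ∀ {L H c c'} → AgreeOn L H c c' →
             ∀ t → AgreeOn (L + + t) (H - + t) (iterF t c) (iterF t c')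
agree-iter {L} {H} {c} {c'} agree zero =
  subst₂ (λ L′ H′ → AgreeOn L′ H′ c c') (sym (ℤP.+-identityʳ L)) (sym (ℤP.+-identityʳ H)) agree
agree-iter {L} {H} {c} {c'} agree (suc t) =
  subst₂ (λ L′ H′ → AgreeOn L′ H′ (iterF (suc t) c) (iterF (suc t) c'))
    (trans (raise L (+ t)) (cong (_+_ L) (sym (ℤP.pos-+ 1 t))))
    (trans (lower H (+ t)) (cong (_-_ H) (sym (ℤP.pos-+ 1 t))))
    (agree-step (agree-iter agree t))
  where
  raise : ∀ (L T : ℤ) → (L + T) + 1ℤ ≡ L + (1ℤ + T)
  raise = solve-∀
  lower : ∀ (H T : ℤ) → (H - T) - 1ℤ ≡ H - (1ℤ + T)
  lower = solve-∀

≤-1⇒< : ∀ {i j} → i ≤ j - 1ℤ → i < j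
≤-1⇒< {i} {j} i≤j-1 = ℤP.i≤pred[j]⇒i<j (subst (i ≤_) (ℤP.+-comm j -1ℤ) i≤j-1)

module Construction (n : ℕ) .{{_ : NonZero n}} (x : Block n) where

  cX cD : Config
  cX = cOf n x
  cD = Dc n x

  L₀ H₀ : ℤ
  L₀ = - + (n ℕ.* n)
  H₀ = + (n ℕ.* n ℕ.+ n) - 1ℤ

  inInterior-true : ∀ {i} → InRange L₀ H₀ i → inInterior n i ≡ true
  inInterior-true ri = Equivalence.to T-≡ (fromWitness ri)

  DBlock-interior : ∀ {i j} → InRange L₀ H₀ i → InRange L₀ H₀ j → DBlock n x (i , j) ≡ cX (i , j)
  DBlock-interior ri rj rewrite inInterior-true ri | inInterior-true rj = refl

  DBlock⊑cX : ∀ i j → DBlock n x (i , j) ≡ true → cX (i , j) ≡ true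
  DBlock⊑cX i j e with inInterior n i | inInterior n j
  DBlock⊑cX i j e  | true  | true  = e
  DBlock⊑cX i j () | true  | false
  DBlock⊑cX i j () | false | _

  repD-congruent : ∀ i → Σ[ q ∈ ℤ ] repD n i ≡ i + q * + n
  repD-congruent i = - (Q * + K) , (begin
    lo n + + (d %ℕ m)                 ≡⟨ cong (_+_ (lo n)) (solve-for d (+ (d %ℕ m)) Q (+ m) euclid) ⟩
    lo n + (d + (- Q) * + m)          ≡⟨ cong (λ z → lo n + (d + (- Q) * z)) (ℤP.pos-* n K) ⟩
    lo n + (d + (- Q) * (+ n * + K))  ≡⟨ regroup (lo n) i Q (+ n) (+ K) ⟩
    i + (- (Q * + K)) * + n           ∎)
    where
    open ≡-Reasoning
    instance m-nz : NonZero (side n)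
    m-nz = side-nz n
    K m : ℕ
    K = 3 ℕ.+ 2 ℕ.* n
    m = side n
    d Q : ℤ
    d = i - lo n
    Q = d /ℕ m
    euclid : d ≡ + (d %ℕ m) + Q * + m
    euclid = a≡a%ℕn+[a/ℕn]*n d m
    regroup : ∀ (lo i Q n K : ℤ) → lo + ((i - lo) + (- Q) * (n * K)) ≡ i + (- (Q * K)) * n
    regroup = solve-∀

  repD-interior : ∀ {i} → InRange L₀ H₀ i → repD n i ≡ i
  repD-interior {i} (L₀≤i , i≤H₀) =
    trans (cong (_+_ (lo n)) (%ℕ-small d m 0≤d d<m)) (cancel (lo n) i)
    where
    instance m-nz : NonZero (side n)
    m-nz = side-nz n
    Q m : ℕ
    Q = n ℕ.* n ℕ.+ n
    m = side n
    d : ℤ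
    d = i - lo n
    cancel : ∀ (l i : ℤ) → l + (i - l) ≡ i
    cancel = solve-∀
    0≤d : 0ℤ ≤ d
    0≤d = ℤP.i≤j⇒0≤j-i (ℤP.≤-trans (ℤP.neg-mono-≤ (+≤+ (ℕP.m≤m+n (n ℕ.* n) n))) L₀≤i)
    2Q≤m : Q ℕ.+ Q ℕ.≤ m
    2Q≤m = subst (Q ℕ.+ Q ℕ.≤_) (side-split n) (ℕP.m≤m+n (Q ℕ.+ Q) n)
      where
      side-split : ∀ n → (n ℕ.* n ℕ.+ n) ℕ.+ (n ℕ.* n ℕ.+ n) ℕ.+ n ≡ n ℕ.* (3 ℕ.+ 2 ℕ.* n)
      side-split = ℕSolver.solve-∀
    d<m : d < + m
    d<m = begin-strict
      i - lo n      <⟨ ℤP.+-monoˡ-< (- lo n) (≤-1⇒< {j = + Q} i≤H₀) ⟩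
      + Q - lo n    ≡⟨ cong (_+_ (+ Q)) (ℤP.neg-involutive (+ Q)) ⟩
      + Q + + Q     ≡⟨ ℤP.pos-+ Q Q ⟨
      + (Q ℕ.+ Q)   ≤⟨ +≤+ 2Q≤m ⟩
      + m           ∎
      where open ℤP.≤-Reasoning

  cD⊑cX : cD ⊑ cX
  cD⊑cX (i , j) active with repD-congruent i | repD-congruent j
  ... | qi , ei | qj , ej =
    trans (sym (cOf-periodic n x qi qj (i , j)))
          (subst₂ (λ p q → cX (p , q) ≡ true) ei ej (DBlock⊑cX (repD n i) (repD n j) active))

  agree-interior : AgreeOn L₀ H₀ cX cD
  agree-interior i j ri rj = sym (begin
    DBlock n x (repD n i , repD n j)
      ≡⟨ cong₂ (λ p q → DBlock n x (p , q)) (repD-interior ri) (repD-interior rj) ⟩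
    DBlock n x (i , j)               ≡⟨ DBlock-interior ri rj ⟩
    cX (i , j)                       ∎)
    where open ≡-Reasoning

  block-in-shrunk-interior : ∀ (a : Fin n) → InRange (L₀ + + (n ℕ.* n)) (H₀ - + (n ℕ.* n)) (+ toℕ a)
  block-in-shrunk-interior a =
    subst (_≤ + toℕ a) (sym (ℤP.+-inverseˡ (+ (n ℕ.* n)))) (+≤+ z≤n) ,
    subst (+ toℕ a ≤_) upper (ℤP.i<j⇒i≤pred[j] (+<+ (toℕ<n a)))
    where
    upper : -1ℤ + + n ≡ H₀ - + (n ℕ.* n)
    upper = trans (sym (shrink (+ (n ℕ.* n)) (+ n)))
                  (cong (λ z → (z - 1ℤ) - + (n ℕ.* n)) (sym (ℤP.pos-+ (n ℕ.* n) n)))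
      where
      shrink : ∀ (N n : ℤ) → ((N + n) - 1ℤ) - N ≡ -1ℤ + n
      shrink = solve-∀

-- Lemma 4: a cell u of the block with x_u = 0 is stable for c(x) iff it is stable
-- for D(c).  (The hypothesis x_u = 0 is also part of each stability claim.)
lemma4 : (n : ℕ) .{{_ : NonZero n}} (x : Block n) (a b : Fin n) →
    x a b ≡ false →
    (Stable (cOf n x) (embed (a , b)) ⇔ Stable (Dc n x) (embed (a , b)))
lemma4 n x a b _ = mk⇔ forward backward
  where
  open Construction n x
  u : Cell
  u = embed (a , b)

  forward : Stable cX u → Stable cD u
  forward (_ , never) = inactive 0 , inactive
    where
    inactive : ∀ t → iterF t cD u ≡ false
    inactive t = ⊑-inactive (iterF-mono cD⊑cX t u) (never t)

  -- (⇐) an activation in cX shows at time n², where cX and cD agree at u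
  backward : Stable cD u → Stable cX u
  backward (_ , never) = inactive 0 , inactive
    where
    agree-n² : iterF (n ℕ.* n) cX u ≡ iterF (n ℕ.* n) cD u
    agree-n² = agree-iter agree-interior (n ℕ.* n) (+ toℕ a) (+ toℕ b)
                 (block-in-shrunk-interior a) (block-in-shrunk-interior b)
    inactive : ∀ t → iterF t cX u ≡ false
    inactive t = ⊑-inactive
      (λ active → trans (sym agree-n²) (periodic-active-by n (cOf-periodic n x) t u active))
      (never (n ℕ.* n))
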